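{- Let $\Sigma$ be a finite totally ordered alphabet and $\mathcal{M}=(T_1,\dots,T_m)$ an ordered collection of nonempty strings over $\Sigma$, with $m'$ distinct strings. Let $t=t[1..m]$ be the input order meta-string of $\mathcal{M}$ and let $\pi_{concat}(t)$ be the output order meta-string of $\mathrm{concatBWT}$ (both defined in the context). Then $\pi_{concat}(t)=\mathrm{BWT}^*(t)$, where for a string $u$, $\mathrm{BWT}^*(u)$ is $\mathrm{BWT}(u\$)$ with the (single occurrence of the) end-of-string symbol $\$$ removed, $\$$ being smaller than all meta-characters.
   Context: $\mathrm{BWT}(T)$ is the string of last characters of all conjugates (rotations $T[i..n]T[1..i-1]$) of $T$ in lexicographic order. Let $\$$ and $\#$ be symbols with $\#<\$<a$ for all $a\in\Sigma$. The meta-string $t$ is the string over an ordered alphabet $a_1<\dots<a_{m'}$ of meta-characters with $t[d]=a_k$ iff $T_d$ has lexicographic rank $k$ among the $m'$ distinct strings of $\mathcal{M}$. Let $X=T_1\$T_2\$\cdots T_m\$\#$ and $\mathrm{concatBWT}(\mathcal{M})=\mathrm{BWT}(X)$. For each $d\in\{1,\dots,m\}$ consider the suffix $Y_d$ of $X$ starting at the $\$$ immediately following $T_d$ (so $Y_d=\$T_{d+1}\$\cdots T_m\$\#$ for $d<m$ and $Y_m=\$\#$). Sort $Y_1,\dots,Y_m$ lexicographically (they are pairwise distinct); $\pi_{concat}(t)$ is the length-$m$ string whose $j$-th character is $t[d]$, where $Y_d$ is the $j$-th smallest of them. Equivalently, $\pi_{concat}(t)$ lists, by the meta-character of their string, the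 strings $T_d$ in the order in which their last characters appear in the block of $\mathrm{concatBWT}(\mathcal{M})$ preceding the rotations starting with $\$$. -}

module Defs where

open import Data.Nat using (ℕ; zero; suc; pred)
import Data.Nat.Properties as ℕP
open import Data.Fin using (Fin; toℕ)
open import Data.List using (List; []; _∷_; _++_; [_]; map; concatMap; drop; take; length;
  filter; deduplicate; upTo; zip; last)
import Data.List.Properties as LP
open import Data.Maybe using (fromMaybe)
open import Data.Product using (_×_; _,_; proj₂)
open import Relation.Nullary using (¬?)
open import Relation.Binary.Bundles using (DecTotalOrder; StrictTotalOrder)
import Data.List.Relation.Binary.Lex.NonStrict as LexNS
import Data.Product.Relation.Binary.Lex.NonStrict as ProdLexNS
import Data.List.Sort as Sort
open import Data.Nat using (_≟_)

-- Strings over ℕ-coded ordered alphabets, compared lexicographically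
-- (standard lexicographic order: a proper prefix is smaller).

Str : Set
Str = List ℕ

lexDTO : DecTotalOrder _ _ _
lexDTO = LexNS.≤-decTotalOrder ℕP.≤-decTotalOrder

lexSTO : StrictTotalOrder _ _ _
lexSTO = LexNS.<-strictTotalOrder ℕP.≤-decTotalOrder

sortStr : List Str → List Str
sortStr = Sort.sort lexDTO

-- last character of a (nonempty) string; default 0 is never used below
lastChar : Str → ℕ
lastChar w = fromMaybe 0 (last w)

rotations : Str → List Str
rotations T = map (λ i → drop i T ++ take i T) (upTo (length T))

BWT : Str → Str
BWT T = map lastChar (sortStr (rotations T))

-- The collection M = (T_1,…,T_m) over Σ = Fin σ (order of Fin).
-- Encoding of the extended alphabet into ℕ:  # ↦ 0,  $ ↦ 1,  a ↦ 2 + toℕ a.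

enc : {σ : ℕ} → Fin σ → ℕ
enc a = suc (suc (toℕ a))

encodeAll : {σ : ℕ} → List (List (Fin σ)) → Str
encodeAll Ms = concatMap (λ T → map enc T ++ [ 1 ]) Ms ++ [ 0 ]

concatString : {σ : ℕ} → List (List (Fin σ)) → Str
concatString M = encodeAll M

concatBWT : {σ : ℕ} → List (List (Fin σ)) → Str
concatBWT M = BWT (concatString M)

-- Y_d = $ T_{d+1} $ ⋯ T_m $ #   (the suffix of X starting at the $ after T_d)
Ysuffix : {σ : ℕ} → List (List (Fin σ)) → ℕ → Str
Ysuffix M d = 1 ∷ encodeAll (drop d M)

-- Meta-string.  Meta-character a_k is represented by k - 1 ∈ ℕ
-- (0-based lexicographic rank among the m' distinct strings of M).

asStr : {σ : ℕ} → List (Fin σ) → Str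
asStr T = map toℕ T

metaRank : {σ : ℕ} → List (List (Fin σ)) → List (Fin σ) → ℕ
metaRank M T =
  length (deduplicate (LP.≡-dec Data.Fin._≟_)
    (filter (λ S → StrictTotalOrder._<?_ lexSTO (asStr S) (asStr T)) M))
  where import Data.Fin

metaString : {σ : ℕ} → List (List (Fin σ)) → List ℕ
metaString M = map (metaRank M) M

-- π_concat(t): the meta-characters t[d] listed in increasing lexicographic
-- order of Y_d.  Pairs (Y_d , t[d]) are sorted lexicographically; since the
-- Y_d are pairwise distinct this is the order of the Y_d.
pairDTO : DecTotalOrder _ _ _
pairDTO = ProdLexNS.×-decTotalOrder lexDTO ℕP.≤-decTotalOrder

piConcat : {σ : ℕ} → List (List (Fin σ)) → List ℕ
piConcat M =
  map proj₂ (Sort.sort pairDTO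
    (zip (map (λ d → Ysuffix M (suc d)) (upTo (length M))) (metaString M)))

-- BWT*(u): BWT(u $) with the $ removed; here $ ↦ 0 and meta-char k ↦ k + 1.

BWTstar : List ℕ → List ℕ
BWTstar u = map pred (filter (λ x → ¬? (x ≟ 0)) (BWT (map suc u ++ [ 0 ])))

data NonEmptyStr {σ : ℕ} : List (Fin σ) → Set where
  nonEmpty : ∀ a T → NonEmptyStr (a ∷ T)

{-# OPTIONS --safe #-}
module Submission where

-- Both sides list the meta-characters t[d] in increasing lexicographic order of the
-- suffixes t[d+1..m] (a proper prefix being smaller).
-- For BWT*(t), the rotation of t$ ending in t[d] is t[d+1..m] $ t[1..d]; as $ occurs
-- once and is the least symbol, two such rotations compare like the suffixes in front of
-- their $.  For π_concat, Y_d = $ T_{d+1} $ ⋯ T_m $ #; as $ is below every letter and # below $,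
-- Y_d and Y_e compare like the sequences (T_{d+1}, …) and (T_{e+1}, …) string by string, that
-- is, like the suffixes of t.  Distinct positions have suffixes of distinct lengths, so neither
-- sort meets a tie and both produce the same order of positions.

open import Defs
open import Function using (_∘_)
open import Data.Empty using (⊥-elim)
open import Data.Unit using (tt)
open import Data.Nat using (ℕ; zero; suc; pred; _≤_; _<_; _≟_; z≤n; s≤s)
import Data.Nat.Properties as ℕ
open import Data.Fin using (Fin; toℕ)
import Data.Fin.Properties as Fin
open import Data.Maybe using (just; fromMaybe)
open import Data.Product using (_×_; _,_; proj₁; proj₂; swap)
open import Data.Sum using (inj₁)
open import Data.List
  using (List; []; _∷_; [_]; _++_; map; filter; deduplicate; length; drop; take; last; zip; upTo; applyUpTo)
import Data.List.Properties as List
open import Data.Bool using (true; false)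
open import Data.List.Membership.Propositional using (_∈_; lose)
open import Data.List.Membership.Propositional.Properties using (∈-filter⁺; ∈-deduplicate⁺)
open import Data.List.Relation.Unary.All as All using (All; []; _∷_)
import Data.List.Relation.Unary.All.Properties as All
open import Data.List.Relation.Unary.Linked as Linked using (Linked; []; [-]; _∷_)
import Data.List.Relation.Unary.Linked.Properties as Linked
open import Data.List.Relation.Unary.Sorted.TotalOrder using (Sorted)
import Data.List.Relation.Unary.Sorted.TotalOrder.Properties as Sorted
open import Data.List.Relation.Binary.Pointwise as Pointwise using (Pointwise-≡⇒≡)
open import Data.List.Relation.Binary.Permutation.Propositional
  using (_↭_; ↭-sym; ↭-trans; ↭⇒↭ₛ)
open import Data.List.Relation.Binary.Permutation.Propositional.Properties
  using (map⁺; filter-↭; All-resp-↭)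
import Data.List.Relation.Binary.Permutation.Homogeneous as Homogeneous
import Data.List.Relation.Binary.Lex.Core as Lex
open import Data.List.Sort as Sort using ()
open import Relation.Nullary using (¬_; yes; no; ¬?; does)
open import Relation.Unary using (Pred; Decidable; _⊆_)
open import Relation.Unary.Properties using (_∩?_)
open import Relation.Binary.Bundles using (DecTotalOrder; StrictTotalOrder)
open import Relation.Binary.Definitions using (DecidableEquality; tri<; tri≈; tri>)
import Relation.Binary.Construct.On as On
open import Relation.Binary.PropositionalEquality hiding ([_])

-- 0-based, with junk value 0 past the end.
infixl 9 _‼_
_‼_ : List ℕ → ℕ → ℕ
[]       ‼ _     = 0
(x ∷ _)  ‼ zero  = x
(_ ∷ xs) ‼ suc i = xs ‼ i

zip-applyUpTo : ∀ {a} {A : Set a} (h : ℕ → A) xs →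
  zip (applyUpTo h (length xs)) xs ≡ applyUpTo (λ i → h i , xs ‼ i) (length xs)
zip-applyUpTo h []       = refl
zip-applyUpTo h (x ∷ xs) = cong ((h 0 , x) ∷_) (zip-applyUpTo (h ∘ suc) xs)

drop-++ˡ : ∀ {a} {A : Set a} i (xs ys : List A) → i ≤ length xs →
           drop i (xs ++ ys) ≡ drop i xs ++ ys
drop-++ˡ zero    xs       ys _         = refl
drop-++ˡ (suc i) (x ∷ xs) ys (s≤s i≤n) = drop-++ˡ i xs ys i≤n

last-++ : ∀ {a} {A : Set a} xs {ys : List A} {y} → last ys ≡ just y → last (xs ++ ys) ≡ just y
last-++ []                 ys≡y = ys≡y
last-++ (x ∷ [])     {_ ∷ _} ys≡y = ys≡y
last-++ (x ∷ x′ ∷ xs)       ys≡y = last-++ (x′ ∷ xs) ys≡y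

last-take-suc : ∀ {i} xs → i < length xs → last (take (suc i) xs) ≡ just (xs ‼ i)
last-take-suc {zero}  (x ∷ xs)      _         = refl
last-take-suc {suc i} (x ∷ x′ ∷ xs) (s≤s i<n) = last-take-suc (x′ ∷ xs) i<n

length-drop-injective : ∀ {a} {A : Set a} {i j} (xs : List A) → i ≤ length xs → j ≤ length xs →
                        length (drop i xs) ≡ length (drop j xs) → i ≡ j
length-drop-injective {i = i} {j} xs i≤n j≤n same = ℕ.∸-cancelˡ-≡ i≤n j≤n
  (trans (sym (List.length-drop i xs)) (trans same (List.length-drop j xs)))

filter-map : ∀ {a b p} {A : Set a} {B : Set b} {P : Pred B p} (P? : Decidable P) (f : A → B) xs →
             filter P? (map f xs) ≡ map f (filter (P? ∘ f) xs)
filter-map P? f []       = refl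
filter-map P? f (x ∷ xs) with does (P? (f x))
... | true  = cong (f x ∷_) (filter-map P? f xs)
... | false = filter-map P? f xs

module _ {a} {A : Set a} where

  filter-filter : ∀ {p q} {P : Pred A p} {Q : Pred A q} (P? : Decidable P) (Q? : Decidable Q) →
                  ∀ xs → filter P? (filter Q? xs) ≡ filter (P? ∩? Q?) xs
  filter-filter P? Q? []       = refl
  filter-filter P? Q? (x ∷ xs) with Q? x
  ... | yes _ with P? x
  ...   | yes _ = cong (x ∷_) (filter-filter P? Q? xs)
  ...   | no _  = filter-filter P? Q? xs
  filter-filter P? Q? (x ∷ xs) | no _ with P? x
  ...   | yes _ = filter-filter P? Q? xs
  ...   | no _  = filter-filter P? Q? xs

  filter-comm : ∀ {p q} {P : Pred A p} {Q : Pred A q} (P? : Decidable P) (Q? : Decidable Q) →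
                ∀ xs → filter P? (filter Q? xs) ≡ filter Q? (filter P? xs)
  filter-comm P? Q? xs = begin
    filter P? (filter Q? xs) ≡⟨ filter-filter P? Q? xs ⟩
    filter (P? ∩? Q?) xs     ≡⟨ List.filter-≐ (P? ∩? Q?) (Q? ∩? P?) (swap , swap) xs ⟩
    filter (Q? ∩? P?) xs     ≡⟨ filter-filter Q? P? xs ⟨
    filter Q? (filter P? xs) ∎
    where open ≡-Reasoning

  filter-absorb : ∀ {p q} {P : Pred A p} {Q : Pred A q} (P? : Decidable P) (Q? : Decidable Q) →
                  P ⊆ Q → ∀ xs → filter P? (filter Q? xs) ≡ filter P? xs
  filter-absorb P? Q? P⊆Q xs = trans (filter-filter P? Q? xs)
    (List.filter-≐ (P? ∩? Q?) P? (proj₁ , λ px → px , P⊆Q px) xs)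

  deduplicate-filter : ∀ {p} {P : Pred A p} (_≟ᴬ_ : DecidableEquality A) (P? : Decidable P) →
    ∀ xs → deduplicate _≟ᴬ_ (filter P? xs) ≡ filter P? (deduplicate _≟ᴬ_ xs)
  deduplicate-filter _≟ᴬ_ P? []       = refl
  deduplicate-filter _≟ᴬ_ P? (x ∷ xs) with P? x
  ... | yes _  = cong (x ∷_) (begin
    filter (≢x) (deduplicate _≟ᴬ_ (filter P? xs))
      ≡⟨ cong (filter (≢x)) (deduplicate-filter _≟ᴬ_ P? xs) ⟩
    filter (≢x) (filter P? (deduplicate _≟ᴬ_ xs))
      ≡⟨ filter-comm (≢x) P? (deduplicate _≟ᴬ_ xs) ⟩
    filter P? (filter (≢x) (deduplicate _≟ᴬ_ xs)) ∎)
    where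
    open ≡-Reasoning
    ≢x : Decidable (x ≢_)
    ≢x = ¬? ∘ (x ≟ᴬ_)
  ... | no ¬px = trans (deduplicate-filter _≟ᴬ_ P? xs)
    (sym (filter-absorb P? (¬? ∘ (x ≟ᴬ_)) (λ py x≡y → ¬px (subst _ (sym x≡y) py))
                        (deduplicate _≟ᴬ_ xs)))

-- Sorting by a key

Linked-map-All : ∀ {a p r s} {A : Set a} {P : Pred A p} {R : A → A → Set r} {S : A → A → Set s} →
                 (∀ {x y} → P x → P y → R x y → S x y) →
                 ∀ {xs} → All P xs → Linked R xs → Linked S xs
Linked-map-All f _                []       = []
Linked-map-All f _                [-]      = [-]
Linked-map-All f (px ∷ py ∷ pxs) (r ∷ rs) = f px py r ∷ Linked-map-All f (py ∷ pxs) rs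

module _ {a ℓ₁ ℓ₂} (O : DecTotalOrder a ℓ₁ ℓ₂)
         (≈⇒≡ : ∀ {x y} → DecTotalOrder._≈_ O x y → x ≡ y) where
  open DecTotalOrder O using (totalOrder; module Eq)
  open Sort O using (sort; sort-↭; sort-↗)

  sort-unique : ∀ {xs ys} → xs ↭ ys → Sorted totalOrder ys → sort xs ≡ ys
  sort-unique {xs} xs↭ys ys↗ = Pointwise-≡⇒≡ (Pointwise.map ≈⇒≡
    (Sorted.↗↭↗⇒≋ totalOrder (sort-↗ xs) ys↗
      (Homogeneous.map Eq.reflexive (↭⇒↭ₛ (↭-trans (sort-↭ xs) xs↭ys)))))

  filter-sort : ∀ {p} {P : Pred _ p} (P? : Decidable P) xs →
                filter P? (sort xs) ≡ sort (filter P? xs)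
  filter-sort P? xs = sym (sort-unique (filter-↭ P? (↭-sym (sort-↭ xs)))
                                       (Sorted.filter⁺ totalOrder P? (sort-↗ xs)))

sortOn : ∀ {a ℓ₁ ℓ₂ i} (O : DecTotalOrder a ℓ₁ ℓ₂) {I : Set i} →
         (I → DecTotalOrder.Carrier O) → List I → List I
sortOn O k = Sort.sort (On.decTotalOrder O k)

sort-map-sortOn : ∀ {a ℓ₁ ℓ₂ b ℓ₃ ℓ₄ i p}
  (O : DecTotalOrder a ℓ₁ ℓ₂) (O′ : DecTotalOrder b ℓ₃ ℓ₄)
  (≈′⇒≡ : ∀ {x y} → DecTotalOrder._≈_ O′ x y → x ≡ y)
  {I : Set i} (k : I → DecTotalOrder.Carrier O) (k′ : I → DecTotalOrder.Carrier O′)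
  {P : Pred I p} {xs : List I} → All P xs →
  (∀ {i j} → P i → P j →
     DecTotalOrder._≤_ O (k i) (k j) → DecTotalOrder._≤_ O′ (k′ i) (k′ j)) →
  Sort.sort O′ (map k′ xs) ≡ map k′ (sortOn O k xs)
sort-map-sortOn O O′ ≈′⇒≡ k k′ {xs = xs} Pxs mono =
  sort-unique O′ ≈′⇒≡ (map⁺ k′ (↭-sym sorted↭xs))
    (Linked.map⁺ (Linked-map-All mono (All-resp-↭ (↭-sym sorted↭xs) Pxs)
                                      (Sort.sort-↗ (On.decTotalOrder O k) xs)))
  where
  sorted↭xs : sortOn O k xs ↭ xs
  sorted↭xs = Sort.sort-↭ (On.decTotalOrder O k) xs

-- Three-way lexicographic comparison: it turns "compares like" arguments into equations.
data Comparison : Set where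
  lt eq gt : Comparison

infixr 5 _then_

_then_ : Comparison → Comparison → Comparison
lt then _ = lt
eq then c = c
gt then _ = gt

then-assoc : ∀ a b c → (a then b) then c ≡ a then (b then c)
then-assoc lt b c = refl
then-assoc eq b c = refl
then-assoc gt b c = refl

compareℕ : ℕ → ℕ → Comparison
compareℕ zero    zero    = eq
compareℕ zero    (suc _) = lt
compareℕ (suc _) zero    = gt
compareℕ (suc m) (suc n) = compareℕ m n

compareLex : List ℕ → List ℕ → Comparison
compareLex []       []       = eq
compareLex []       (_ ∷ _)  = lt
compareLex (_ ∷ _)  []       = gt
compareLex (x ∷ xs) (y ∷ ys) = compareℕ x y then compareLex xs ys

compareℕ-refl : ∀ n → compareℕ n n ≡ eq
compareℕ-refl zero    = refl
compareℕ-refl (suc n) = compareℕ-refl n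

compareℕ-< : ∀ {m n} → m < n → compareℕ m n ≡ lt
compareℕ-< {zero}  {suc n} _         = refl
compareℕ-< {suc m} {suc n} (s≤s m<n) = compareℕ-< m<n

compareℕ-> : ∀ {m n} → n < m → compareℕ m n ≡ gt
compareℕ-> {suc m} {zero}  _         = refl
compareℕ-> {suc m} {suc n} (s≤s n<m) = compareℕ-> n<m

compareℕ-lt⇒< : ∀ {m n} → compareℕ m n ≡ lt → m < n
compareℕ-lt⇒< {zero}  {suc n} _ = s≤s z≤n
compareℕ-lt⇒< {suc m} {suc n} c = s≤s (compareℕ-lt⇒< c)

compareℕ-eq⇒≡ : ∀ {m n} → compareℕ m n ≡ eq → m ≡ n
compareℕ-eq⇒≡ {zero}  {zero}  _ = refl
compareℕ-eq⇒≡ {suc m} {suc n} c = cong suc (compareℕ-eq⇒≡ c)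

_≤ₗₑₓ_ : List ℕ → List ℕ → Set
_≤ₗₑₓ_ = DecTotalOrder._≤_ lexDTO

_<ₗₑₓ_ : List ℕ → List ℕ → Set
_<ₗₑₓ_ = StrictTotalOrder._<_ lexSTO

compareLex-refl : ∀ xs → compareLex xs xs ≡ eq
compareLex-refl []       = refl
compareLex-refl (x ∷ xs) rewrite compareℕ-refl x = compareLex-refl xs

compareLex-eq⇒≡ : ∀ {xs ys} → compareLex xs ys ≡ eq → xs ≡ ys
compareLex-eq⇒≡ {[]}     {[]}     _ = refl
compareLex-eq⇒≡ {x ∷ xs} {y ∷ ys} c with compareℕ x y in x≟y
... | eq = cong₂ _∷_ (compareℕ-eq⇒≡ x≟y) (compareLex-eq⇒≡ c)

<⇒compareLex-lt : ∀ {xs ys} → xs <ₗₑₓ ys → compareLex xs ys ≡ lt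
<⇒compareLex-lt Lex.halt                  = refl
<⇒compareLex-lt (Lex.this (x≤y , x≢y))
  rewrite compareℕ-< (ℕ.≤∧≢⇒< x≤y x≢y) = refl
<⇒compareLex-lt {x ∷ _} (Lex.next refl p)
  rewrite compareℕ-refl x = <⇒compareLex-lt p

>⇒compareLex-gt : ∀ {xs ys} → ys <ₗₑₓ xs → compareLex xs ys ≡ gt
>⇒compareLex-gt Lex.halt                  = refl
>⇒compareLex-gt (Lex.this (y≤x , y≢x))
  rewrite compareℕ-> (ℕ.≤∧≢⇒< y≤x y≢x) = refl
>⇒compareLex-gt {x ∷ _} (Lex.next refl p)
  rewrite compareℕ-refl x = >⇒compareLex-gt p

≤⇒compareLex-≢gt : ∀ {xs ys} → xs ≤ₗₑₓ ys → compareLex xs ys ≢ gt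
≤⇒compareLex-≢gt (Lex.base _)           ()
≤⇒compareLex-≢gt Lex.halt               ()
≤⇒compareLex-≢gt (Lex.this (x≤y , x≢y))
  rewrite compareℕ-< (ℕ.≤∧≢⇒< x≤y x≢y) = λ ()
≤⇒compareLex-≢gt {x ∷ _} (Lex.next refl p)
  rewrite compareℕ-refl x = ≤⇒compareLex-≢gt p

compareLex-≢gt⇒≤ : ∀ {xs ys} → compareLex xs ys ≢ gt → xs ≤ₗₑₓ ys
compareLex-≢gt⇒≤ {[]}     {[]}     _  = Lex.base tt
compareLex-≢gt⇒≤ {[]}     {_ ∷ _}  _  = Lex.halt
compareLex-≢gt⇒≤ {_ ∷ _}  {[]}     ≢gt = ⊥-elim (≢gt refl)
compareLex-≢gt⇒≤ {x ∷ xs} {y ∷ ys} ≢gt with compareℕ x y in x≟y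
... | lt = Lex.this (ℕ.<⇒≤ x<y , ℕ.<⇒≢ x<y) where x<y = compareℕ-lt⇒< x≟y
... | eq = Lex.next (compareℕ-eq⇒≡ x≟y) (compareLex-≢gt⇒≤ ≢gt)
... | gt = ⊥-elim (≢gt refl)

≤ₗₑₓ-by-compareLex : ∀ {xs ys us vs} → compareLex xs ys ≡ compareLex us vs →
                     us ≤ₗₑₓ vs → xs ≤ₗₑₓ ys
≤ₗₑₓ-by-compareLex same us≤vs =
  compareLex-≢gt⇒≤ (λ gt → ≤⇒compareLex-≢gt us≤vs (trans (sym same) gt))

≢-by-compareLex : ∀ {xs ys us vs} → compareLex xs ys ≡ compareLex us vs → us ≢ vs → xs ≢ ys
≢-by-compareLex {xs} same us≢vs refl =
  us≢vs (compareLex-eq⇒≡ (trans (sym same) (compareLex-refl xs)))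

-- Rotations of u$ and BWT*

withSentinel : List ℕ → List ℕ
withSentinel u = map suc u ++ [ 0 ]

rotation : List ℕ → ℕ → List ℕ
rotation w i = drop i w ++ take i w

suffixOrder : List ℕ → List ℕ
suffixOrder u = sortOn lexDTO (λ d → drop (suc d) u) (upTo (length u))

length-withSentinel : ∀ u → length (withSentinel u) ≡ suc (length u)
length-withSentinel []      = refl
length-withSentinel (_ ∷ u) = cong suc (length-withSentinel u)

withSentinel-‼ : ∀ {d} u → d < length u → withSentinel u ‼ d ≡ suc (u ‼ d)
withSentinel-‼ {zero}  (x ∷ u) _         = refl
withSentinel-‼ {suc d} (x ∷ u) (s≤s d<n) = withSentinel-‼ u d<n

compareLex-sentinel : ∀ a b {x y} → length a ≢ length b →
  compareLex (map suc a ++ 0 ∷ x) (map suc b ++ 0 ∷ y) ≡ compareLex a b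
compareLex-sentinel []      []      |a|≢|b| = ⊥-elim (|a|≢|b| refl)
compareLex-sentinel []      (_ ∷ _) _       = refl
compareLex-sentinel (_ ∷ _) []      _       = refl
compareLex-sentinel (p ∷ a) (q ∷ b) |a|≢|b| =
  cong (compareℕ p q then_) (compareLex-sentinel a b (|a|≢|b| ∘ cong suc))

module _ (u : List ℕ) where
  private
    w : List ℕ
    w = withSentinel u
    n : ℕ
    n = length u

  rotation-suc : ∀ {d} → d < n →
                 rotation w (suc d) ≡ map suc (drop (suc d) u) ++ 0 ∷ take (suc d) w
  rotation-suc {d} d<n = begin
    drop (suc d) (map suc u ++ [ 0 ]) ++ take (suc d) w
      ≡⟨ cong (_++ take (suc d) w)
              (drop-++ˡ (suc d) (map suc u) [ 0 ] (subst (suc d ≤_) (sym (List.length-map suc u)) d<n)) ⟩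
    (drop (suc d) (map suc u) ++ [ 0 ]) ++ take (suc d) w
      ≡⟨ cong (λ v → (v ++ [ 0 ]) ++ take (suc d) w) (List.drop-map (suc d) u) ⟩
    (map suc (drop (suc d) u) ++ [ 0 ]) ++ take (suc d) w
      ≡⟨ List.++-assoc (map suc (drop (suc d) u)) [ 0 ] (take (suc d) w) ⟩
    map suc (drop (suc d) u) ++ 0 ∷ take (suc d) w ∎
    where open ≡-Reasoning

  lastChar-rotation-zero : lastChar (rotation w 0) ≡ 0
  lastChar-rotation-zero rewrite List.++-identityʳ w =
    cong (fromMaybe 0) (last-++ (map suc u) {[ 0 ]} refl)

  lastChar-rotation-suc : ∀ {d} → d < n → lastChar (rotation w (suc d)) ≡ suc (u ‼ d)
  lastChar-rotation-suc {d} d<n = begin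
    lastChar (drop (suc d) w ++ take (suc d) w)
      ≡⟨ cong (fromMaybe 0) (last-++ (drop (suc d) w) (last-take-suc w d<|w|)) ⟩
    w ‼ d
      ≡⟨ withSentinel-‼ u d<n ⟩
    suc (u ‼ d) ∎
    where
    open ≡-Reasoning
    d<|w| : d < length w
    d<|w| = subst (d <_) (sym (length-withSentinel u)) (ℕ.m<n⇒m<1+n d<n)

  rotations-withSentinel : rotations w ≡ rotation w 0 ∷ map (rotation w ∘ suc) (upTo n)
  rotations-withSentinel = begin
    map (rotation w) (upTo (length w))
      ≡⟨ cong (map (rotation w) ∘ upTo) (length-withSentinel u) ⟩
    rotation w 0 ∷ map (rotation w) (applyUpTo suc n)
      ≡⟨ cong (rotation w 0 ∷_) (List.map-applyUpTo suc (rotation w) n) ⟩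
    rotation w 0 ∷ applyUpTo (rotation w ∘ suc) n
      ≡⟨ cong (rotation w 0 ∷_) (sym (List.map-upTo (rotation w ∘ suc) n)) ⟩
    rotation w 0 ∷ map (rotation w ∘ suc) (upTo n) ∎
    where open ≡-Reasoning

  compareLex-rotation : ∀ {d e} → d < n → e < n → d ≢ e →
    compareLex (rotation w (suc d)) (rotation w (suc e)) ≡ compareLex (drop (suc d) u) (drop (suc e) u)
  compareLex-rotation d<n e<n d≢e rewrite rotation-suc d<n | rotation-suc e<n =
    compareLex-sentinel (drop (suc _) u) (drop (suc _) u)
      (d≢e ∘ ℕ.suc-injective ∘ length-drop-injective u d<n e<n)

  private
    nonzero : Decidable (_≢ 0)
    nonzero x = ¬? (x ≟ 0)

    lastChar-nonzero : Decidable ((_≢ 0) ∘ lastChar)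
    lastChar-nonzero = nonzero ∘ lastChar

  filter-rotations-withSentinel :
    filter lastChar-nonzero (rotations w) ≡ map (rotation w ∘ suc) (upTo n)
  filter-rotations-withSentinel rewrite rotations-withSentinel =
    trans (List.filter-reject lastChar-nonzero {rotation w 0} {map (rotation w ∘ suc) (upTo n)}
                              (λ ≢0 → ≢0 lastChar-rotation-zero))
          (List.filter-all lastChar-nonzero
            (All.map⁺ (All.map (λ d<n → ℕ.1+n≢0 ∘ trans (sym (lastChar-rotation-suc d<n)))
                               (All.all-upTo n))))

  map-lastChar-rotation : ∀ {ds} → All (_< n) ds →
    map pred (map lastChar (map (rotation w ∘ suc) ds)) ≡ map (u ‼_) ds
  map-lastChar-rotation []           = refl
  map-lastChar-rotation (d<n ∷ ds<n) =
    cong₂ _∷_ (cong pred (lastChar-rotation-suc d<n)) (map-lastChar-rotation ds<n)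

  rotation-mono : ∀ {d e} → d < n → e < n → drop (suc d) u ≤ₗₑₓ drop (suc e) u →
                  rotation w (suc d) ≤ₗₑₓ rotation w (suc e)
  rotation-mono {d} {e} d<n e<n sd≤se with d ≟ e
  ... | yes refl = DecTotalOrder.refl lexDTO
  ... | no d≢e   = ≤ₗₑₓ-by-compareLex (compareLex-rotation d<n e<n d≢e) sd≤se

  BWTstar-suffixOrder : BWTstar u ≡ map (u ‼_) (suffixOrder u)
  BWTstar-suffixOrder = begin
    map pred (filter nonzero (map lastChar (sortStr (rotations w))))
      ≡⟨ cong (map pred) (filter-map nonzero lastChar (sortStr (rotations w))) ⟩
    map pred (map lastChar (filter lastChar-nonzero (sortStr (rotations w))))
      ≡⟨ cong (map pred ∘ map lastChar)
              (filter-sort lexDTO Pointwise-≡⇒≡ lastChar-nonzero (rotations w)) ⟩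
    map pred (map lastChar (sortStr (filter lastChar-nonzero (rotations w))))
      ≡⟨ cong (map pred ∘ map lastChar ∘ sortStr) filter-rotations-withSentinel ⟩
    map pred (map lastChar (sortStr (map (rotation w ∘ suc) (upTo n))))
      ≡⟨ cong (map pred ∘ map lastChar)
              (sort-map-sortOn lexDTO lexDTO Pointwise-≡⇒≡
                               (λ d → drop (suc d) u) (rotation w ∘ suc) (All.all-upTo n) rotation-mono) ⟩
    map pred (map lastChar (map (rotation w ∘ suc) (suffixOrder u)))
      ≡⟨ map-lastChar-rotation (All-resp-↭ (↭-sym (Sort.sort-↭ _ (upTo n))) (All.all-upTo n)) ⟩
    map (u ‼_) (suffixOrder u) ∎
    where open ≡-Reasoning

-- Ranks of the strings of M

module _ {σ : ℕ} (M : List (List (Fin σ))) where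
  private
    module LexS = StrictTotalOrder lexSTO
    _≟ˢ_ : DecidableEquality (List (Fin σ))
    _≟ˢ_ = List.≡-dec Fin._≟_
    below : (T : List (Fin σ)) → Decidable (λ (S : List (Fin σ)) → asStr S <ₗₑₓ asStr T)
    below T S = asStr S LexS.<? asStr T

  -- T is counted in the rank of T′ but not in its own.
  metaRank-mono : ∀ {T T′} → T ∈ M → asStr T <ₗₑₓ asStr T′ → metaRank M T < metaRank M T′
  metaRank-mono {T} {T′} T∈M T<T′ = begin-strict
    metaRank M T
      ≡⟨ cong length (deduplicate-filter _≟ˢ_ (below T) M) ⟩
    length (filter (below T) D)
      ≡⟨ cong length (filter-absorb (below T) (below T′) (λ S<T → LexS.trans S<T T<T′) D) ⟨
    length (filter (below T) (filter (below T′) D))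
      <⟨ List.filter-notAll (below T) (filter (below T′) D)
           (lose (∈-filter⁺ (below T′) (∈-deduplicate⁺ _≟ˢ_ T∈M) T<T′)
                 (LexS.irrefl (Pointwise.refl refl))) ⟩
    length (filter (below T′) D)
      ≡⟨ cong length (deduplicate-filter _≟ˢ_ (below T′) M) ⟨
    metaRank M T′ ∎
    where
    open ℕ.≤-Reasoning
    D : List (List (Fin σ))
    D = deduplicate _≟ˢ_ M

  compareℕ-metaRank : ∀ {T T′} → T ∈ M → T′ ∈ M →
    compareℕ (metaRank M T) (metaRank M T′) ≡ compareLex (asStr T) (asStr T′)
  compareℕ-metaRank {T} {T′} T∈M T′∈M with LexS.compare (asStr T) (asStr T′)
  ... | tri< T<T′ _ _ rewrite <⇒compareLex-lt T<T′ = compareℕ-< (metaRank-mono T∈M T<T′)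
  ... | tri> _ _ T′<T rewrite >⇒compareLex-gt T′<T = compareℕ-> (metaRank-mono T′∈M T′<T)
  ... | tri≈ _ T≈T′ _ rewrite List.map-injective Fin.toℕ-injective (Pointwise-≡⇒≡ T≈T′) =
    trans (compareℕ-refl (metaRank M T′)) (sym (compareLex-refl (asStr T′)))

-- The suffixes Y_d of X

encodeAll-∷ : ∀ {σ} (T : List (Fin σ)) Ms → encodeAll (T ∷ Ms) ≡ map enc T ++ 1 ∷ encodeAll Ms
encodeAll-∷ T Ms = trans (List.++-assoc (map enc T ++ [ 1 ]) _ [ 0 ])
                         (List.++-assoc (map enc T) [ 1 ] _)

compareLex-$-terminated : ∀ {σ} (T T′ : List (Fin σ)) X X′ →
  compareLex (map enc T ++ 1 ∷ X) (map enc T′ ++ 1 ∷ X′) ≡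
  compareLex (asStr T) (asStr T′) then compareLex X X′
compareLex-$-terminated []      []       X X′ = refl
compareLex-$-terminated []      (_ ∷ _)  X X′ = refl
compareLex-$-terminated (_ ∷ _) []       X X′ = refl
compareLex-$-terminated (a ∷ T) (b ∷ T′) X X′ =
  trans (cong (compareℕ (toℕ a) (toℕ b) then_) (compareLex-$-terminated T T′ X X′))
        (sym (then-assoc (compareℕ (toℕ a) (toℕ b)) _ _))

pair-≈⇒≡ : ∀ {x y} → DecTotalOrder._≈_ pairDTO x y → x ≡ y
pair-≈⇒≡ (x₁≈y₁ , x₂≡y₂) = cong₂ _,_ (Pointwise-≡⇒≡ x₁≈y₁) x₂≡y₂

module _ {σ : ℕ} (M : List (List (Fin σ))) where
  private
    t : List ℕ
    t = metaString M
    n : ℕ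
    n = length t

  compareLex-encodeAll : ∀ {Ms Ms′} → All (_∈ M) Ms → All (_∈ M) Ms′ →
    compareLex (encodeAll Ms) (encodeAll Ms′) ≡ compareLex (map (metaRank M) Ms) (map (metaRank M) Ms′)
  compareLex-encodeAll {[]}           {[]}            _ _ = refl
  compareLex-encodeAll {[]}           {[] ∷ _}        _ _ = refl
  compareLex-encodeAll {[]}           {(_ ∷ _) ∷ _}   _ _ = refl
  compareLex-encodeAll {[] ∷ _}       {[]}            _ _ = refl
  compareLex-encodeAll {(_ ∷ _) ∷ _}  {[]}            _ _ = refl
  compareLex-encodeAll {T ∷ Ms} {T′ ∷ Ms′} (T∈M ∷ Ms⊆M) (T′∈M ∷ Ms′⊆M) = begin
    compareLex (encodeAll (T ∷ Ms)) (encodeAll (T′ ∷ Ms′))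
      ≡⟨ cong₂ compareLex (encodeAll-∷ T Ms) (encodeAll-∷ T′ Ms′) ⟩
    compareLex (map enc T ++ 1 ∷ encodeAll Ms) (map enc T′ ++ 1 ∷ encodeAll Ms′)
      ≡⟨ compareLex-$-terminated T T′ (encodeAll Ms) (encodeAll Ms′) ⟩
    compareLex (asStr T) (asStr T′) then compareLex (encodeAll Ms) (encodeAll Ms′)
      ≡⟨ cong₂ _then_ (sym (compareℕ-metaRank M T∈M T′∈M)) (compareLex-encodeAll Ms⊆M Ms′⊆M) ⟩
    compareℕ (metaRank M T) (metaRank M T′) then
      compareLex (map (metaRank M) Ms) (map (metaRank M) Ms′) ∎
    where open ≡-Reasoning

  compareLex-Ysuffix : ∀ i j → compareLex (Ysuffix M i) (Ysuffix M j) ≡ compareLex (drop i t) (drop j t)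
  compareLex-Ysuffix i j = begin
    compareLex (encodeAll (drop i M)) (encodeAll (drop j M))
      ≡⟨ compareLex-encodeAll (All.drop⁺ i M⊆M) (All.drop⁺ j M⊆M) ⟩
    compareLex (map (metaRank M) (drop i M)) (map (metaRank M) (drop j M))
      ≡⟨ cong₂ compareLex (List.drop-map i M) (List.drop-map j M) ⟨
    compareLex (drop i t) (drop j t) ∎
    where
    open ≡-Reasoning
    M⊆M : All (_∈ M) M
    M⊆M = All.tabulate (λ T∈M → T∈M)

  private
    key : ℕ → List ℕ × ℕ
    key d = Ysuffix M (suc d) , t ‼ d

  -- Distinct positions have distinct Y's, so the meta-character component is never consulted.
  key-mono : ∀ {d e} → d < n → e < n → drop (suc d) t ≤ₗₑₓ drop (suc e) t →
             DecTotalOrder._≤_ pairDTO (key d) (key e)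
  key-mono {d} {e} d<n e<n sd≤se with d ≟ e
  ... | yes refl = DecTotalOrder.refl pairDTO
  ... | no d≢e   = inj₁ (≤ₗₑₓ-by-compareLex (compareLex-Ysuffix (suc d) (suc e)) sd≤se ,
                         ≢-by-compareLex (compareLex-Ysuffix (suc d) (suc e)) sd≢se ∘ Pointwise-≡⇒≡)
    where
    sd≢se : drop (suc d) t ≢ drop (suc e) t
    sd≢se = d≢e ∘ ℕ.suc-injective ∘ length-drop-injective t d<n e<n ∘ cong length

  piConcat-suffixOrder : piConcat M ≡ map (t ‼_) (suffixOrder t)
  piConcat-suffixOrder = begin
    map proj₂ (Sort.sort pairDTO (zip (map Y (upTo (length M))) t))
      ≡⟨ cong (λ k → map proj₂ (Sort.sort pairDTO (zip (map Y (upTo k)) t)))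
              (List.length-map (metaRank M) M) ⟨
    map proj₂ (Sort.sort pairDTO (zip (map Y (upTo n)) t))
      ≡⟨ cong (λ ys → map proj₂ (Sort.sort pairDTO (zip ys t))) (List.map-upTo Y n) ⟩
    map proj₂ (Sort.sort pairDTO (zip (applyUpTo Y n) t))
      ≡⟨ cong (map proj₂ ∘ Sort.sort pairDTO)
              (trans (zip-applyUpTo Y t) (sym (List.map-upTo key n))) ⟩
    map proj₂ (Sort.sort pairDTO (map key (upTo n)))
      ≡⟨ cong (map proj₂) (sort-map-sortOn lexDTO pairDTO pair-≈⇒≡ (λ d → drop (suc d) t) key
                                           (All.all-upTo n) key-mono) ⟩
    map proj₂ (map key (suffixOrder t))
      ≡⟨ List.map-∘ (suffixOrder t) ⟨
    map (t ‼_) (suffixOrder t) ∎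
    where
    open ≡-Reasoning
    Y : ℕ → List ℕ
    Y d = Ysuffix M (suc d)

lemma15 : (σ : ℕ) (M : List (List (Fin σ))) → All NonEmptyStr M →
    piConcat M ≡ BWTstar (metaString M)
lemma15 σ M _ = trans (piConcat-suffixOrder M) (sym (BWTstar-suffixOrder (metaString M)))
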